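{- The sign pattern $\begin{bmatrix}0&+&0\\-&-&+\\+&-&0\end{bmatrix}$ requires algebraic positivity.
   Context: For a sign pattern $S$ (matrix with entries in $\{+,-,0\}$), $Q(S)$ is the set of real matrices $X$ with $\mathrm{sgn}(X_{ij})=S_{ij}$ for all $i,j$. A real square matrix $M$ is algebraically positive if there is a real polynomial $p$ with all entries of $p(M)$ positive. $S$ requires algebraic positivity if every $X\in Q(S)$ is algebraically positive. -}

module Defs where

open import Level using (0ℓ)
open import Data.Nat using (ℕ; zero; suc)
open import Data.Fin as Fin using (Fin)
open import Relation.Nullary using (yes; no)
open import Data.List using (List; []; _∷_)
open import Data.Product using (Σ; _×_; _,_; ∃)
open import Data.Sum using (_⊎_)
open import Relation.Nullary using (¬_)
open import Relation.Binary.PropositionalEquality using (_≡_)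
open import Algebra.Structures using (IsCommutativeRing)

-- The real numbers, given axiomatically as a complete ordered field.
-- (Every model is isomorphic to ℝ.)  Equality is propositional.
record RealField : Set₁ where
  infixl 6 _+_
  infixl 7 _*_
  infix 4 _<_
  field
    ℝ    : Set
    _+_  : ℝ → ℝ → ℝ
    _*_  : ℝ → ℝ → ℝ
    -_   : ℝ → ℝ
    0ℝ   : ℝ
    1ℝ   : ℝ
    _<_  : ℝ → ℝ → Set
    isCommutativeRing : IsCommutativeRing _≡_ _+_ _*_ -_ 0ℝ 1ℝ
    0≢1   : ¬ (0ℝ ≡ 1ℝ)
    inverse : ∀ x → ¬ (x ≡ 0ℝ) → Σ ℝ λ y → x * y ≡ 1ℝ
    <-irrefl : ∀ x → ¬ (x < x)
    <-trans  : ∀ {x y z} → x < y → y < z → x < z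
    trichotomy : ∀ x y → x < y ⊎ x ≡ y ⊎ y < x
    +-mono-< : ∀ {x y} z → x < y → x + z < y + z
    *-pos    : ∀ {x y} → 0ℝ < x → 0ℝ < y → 0ℝ < x * y
    completeness : (P : ℝ → Set) → (∃ λ x → P x) →
                   (∃ λ b → ∀ x → P x → x < b ⊎ x ≡ b) →
                   ∃ λ s → (∀ x → P x → x < s ⊎ x ≡ s) ×
                           (∀ b → (∀ x → P x → x < b ⊎ x ≡ b) → s < b ⊎ s ≡ b)

data Sign : Set where
  ⊕ ⊖ ⊘ : Sign

module Real (R : RealField) where
  open RealField R public

  HasSign : Sign → ℝ → Set
  HasSign ⊕ x = 0ℝ < x
  HasSign ⊖ x = x < 0ℝ
  HasSign ⊘ x = x ≡ 0ℝ

  Mat : ℕ → Set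
  Mat n = Fin n → Fin n → ℝ

  sumF : ∀ {n} → (Fin n → ℝ) → ℝ
  sumF {zero}  f = 0ℝ
  sumF {suc n} f = f Fin.zero + sumF (λ i → f (Fin.suc i))

  _⊞_ : ∀ {n} → Mat n → Mat n → Mat n
  (A ⊞ B) i j = A i j + B i j

  _⊠_ : ∀ {n} → Mat n → Mat n → Mat n
  (A ⊠ B) i j = sumF (λ k → A i k * B k j)

  _·_ : ∀ {n} → ℝ → Mat n → Mat n
  (c · A) i j = c * A i j

  I : ∀ {n} → Mat n
  I i j with i Fin.≟ j
  ... | yes _ = 1ℝ
  ... | no  _ = 0ℝ

  O : ∀ {n} → Mat n
  O i j = 0ℝ

  -- p(M) for p given by coefficient list c₀ ∷ c₁ ∷ … (Horner: c₀ I + M (c₁ I + M (…)))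
  evalPoly : ∀ {n} → List ℝ → Mat n → Mat n
  evalPoly []       M = O
  evalPoly (c ∷ cs) M = (c · I) ⊞ (M ⊠ evalPoly cs M)

  InQ : ∀ {n} → (Fin n → Fin n → Sign) → Mat n → Set
  InQ S X = ∀ i j → HasSign (S i j) (X i j)

  AlgebraicallyPositive : ∀ {n} → Mat n → Set
  AlgebraicallyPositive M = Σ (List ℝ) λ p → ∀ i j → 0ℝ < evalPoly p M i j

  RequiresAP : ∀ {n} → (Fin n → Fin n → Sign) → Set
  RequiresAP S = ∀ X → InQ S X → AlgebraicallyPositive X

S₁₃ : Fin 3 → Fin 3 → Sign
S₁₃ i j = row i j
  where
  row : Fin 3 → Fin 3 → Sign
  row Fin.zero Fin.zero = ⊘
  row Fin.zero (Fin.suc Fin.zero) = ⊕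
  row Fin.zero (Fin.suc (Fin.suc Fin.zero)) = ⊘
  row (Fin.suc Fin.zero) Fin.zero = ⊖
  row (Fin.suc Fin.zero) (Fin.suc Fin.zero) = ⊖
  row (Fin.suc Fin.zero) (Fin.suc (Fin.suc Fin.zero)) = ⊕
  row (Fin.suc (Fin.suc Fin.zero)) Fin.zero = ⊕
  row (Fin.suc (Fin.suc Fin.zero)) (Fin.suc Fin.zero) = ⊖
  row (Fin.suc (Fin.suc Fin.zero)) (Fin.suc (Fin.suc Fin.zero)) = ⊘

-- Every X ∈ Q(S₁₃) has the form [[0,a,0],[-b,-c,d],[e,-f,0]]
-- with a,…,f > 0.  With  δ = d e f + a b e,  β = c δ + a d e²  and
-- α = 1 + a c d e² + δ (a b + d f),  each entry of p(X) = α I + β X + δ X²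
-- is a polynomial in a,…,f built from 1 and the variables by sums and
-- products only (e.g. the (1,2) entry is a² d e²), hence positive.

module Submission where

open import Defs
open import Level using (0ℓ)
open import Algebra using (CommutativeRing)
open import Data.Nat as ℕ using (ℕ; zero; suc)
open import Data.Integer as ℤ using (ℤ; +_; -[1+_])
import Data.Sign as Sign
import Data.Integer.Properties as ℤ
import Data.Nat.Properties as ℕ
open import Data.Fin as Fin using (Fin) renaming (zero to f0; suc to fs)
open import Data.Vec using (Vec; []; _∷_; lookup)
open import Data.List as List using (List; []; _∷_)
open import Data.Maybe using (just; nothing)
open import Data.Empty using (⊥-elim)
open import Data.Sum using (inj₁; inj₂)
open import Data.Product using (_,_)
open import Relation.Binary.Definitions using (WeaklyDecidable)
open import Relation.Nullary using (yes; no)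
open import Relation.Binary.PropositionalEquality as ≡ using (_≡_)
import Algebra.Solver.Ring
open import Algebra.Solver.Ring.AlmostCommutativeRing
  using (fromCommutativeRing; _-Raw-AlmostCommutative⟶_; Induced-equivalence)

-- The canonical ring homomorphism ℤ → R into a commutative ring R.  It is
-- what allows the ring solver with (computable) integer coefficients to
-- decide polynomial identities over R.
module IntegerEmbedding {c ℓ} (CR : CommutativeRing c ℓ) where
  open CommutativeRing CR
  open import Algebra.Properties.Ring ring
    using (-0#≈0#; -‿involutive; -‿+-comm; -‿distribˡ-*; -‿distribʳ-*)
  open import Algebra.Properties.Semiring.Mult.TCOptimised semiring
    using (_×_; 1+×; ×-homo-+; ×1-homo-*)
  open import Relation.Binary.Reasoning.Setoid setoid

  fromℤ : ℤ → Carrier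
  fromℤ (+ n)    = n × 1#
  fromℤ -[1+ n ] = - (suc n × 1#)

  cancel-1# : ∀ x y → (1# + x) + - (1# + y) ≈ x + - y
  cancel-1# x y = begin
    (1# + x) + - (1# + y)      ≈⟨ +-congˡ (-‿+-comm 1# y) ⟨
    (1# + x) + (- 1# + - y)    ≈⟨ +-congʳ (+-comm 1# x) ⟩
    (x + 1#) + (- 1# + - y)    ≈⟨ +-assoc x 1# _ ⟩
    x + (1# + (- 1# + - y))    ≈⟨ +-congˡ (+-assoc 1# (- 1#) _) ⟨
    x + ((1# + - 1#) + - y)    ≈⟨ +-congˡ (+-congʳ (-‿inverseʳ 1#)) ⟩
    x + (0# + - y)             ≈⟨ +-congˡ (+-identityˡ _) ⟩
    x + - y                    ∎

  fromℤ-⊖ : ∀ m n → fromℤ (m ℤ.⊖ n) ≈ m × 1# + - (n × 1#)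
  fromℤ-⊖ m zero = begin
    m × 1#          ≈⟨ +-identityʳ _ ⟨
    m × 1# + 0#     ≈⟨ +-congˡ -0#≈0# ⟨
    m × 1# + - 0#   ∎
  fromℤ-⊖ zero (suc n) = sym (+-identityˡ _)
  fromℤ-⊖ (suc m) (suc n) = begin
    fromℤ (suc m ℤ.⊖ suc n)                ≡⟨ ≡.cong fromℤ (ℤ.[1+m]⊖[1+n]≡m⊖n m n) ⟩
    fromℤ (m ℤ.⊖ n)                        ≈⟨ fromℤ-⊖ m n ⟩
    m × 1# + - (n × 1#)                    ≈⟨ cancel-1# _ _ ⟨
    (1# + m × 1#) + - (1# + n × 1#)        ≈⟨ +-cong (1+× m 1#) (-‿cong (1+× n 1#)) ⟨
    suc m × 1# + - (suc n × 1#)            ∎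

  fromℤ-+ : ∀ i j → fromℤ (i ℤ.+ j) ≈ fromℤ i + fromℤ j
  fromℤ-+ (+ m)    (+ n)    = ×-homo-+ 1# m n
  fromℤ-+ (+ m)    -[1+ n ] = fromℤ-⊖ m (suc n)
  fromℤ-+ -[1+ m ] (+ n)    = trans (fromℤ-⊖ n (suc m)) (+-comm _ _)
  fromℤ-+ -[1+ m ] -[1+ n ] = begin
    - (suc (suc (m ℕ.+ n)) × 1#)           ≡⟨ ≡.cong (λ k → - (suc k × 1#)) (ℕ.+-suc m n) ⟨
    - ((suc m ℕ.+ suc n) × 1#)             ≈⟨ -‿cong (×-homo-+ 1# (suc m) (suc n)) ⟩
    - (suc m × 1# + suc n × 1#)            ≈⟨ -‿+-comm _ _ ⟨
    - (suc m × 1#) + - (suc n × 1#)        ∎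

  fromℤ-neg : ∀ i → fromℤ (ℤ.- i) ≈ - fromℤ i
  fromℤ-neg (+ zero)  = sym -0#≈0#
  fromℤ-neg (+ suc n) = refl
  fromℤ-neg -[1+ n ]  = sym (-‿involutive _)

  signed : Sign.Sign → Carrier → Carrier
  signed Sign.+ x = x
  signed Sign.- x = - x

  fromℤ-◃ : ∀ s n → fromℤ (s ℤ.◃ n) ≈ signed s (n × 1#)
  fromℤ-◃ Sign.+ n = reflexive (≡.cong fromℤ (ℤ.+◃n≡+n n))
  fromℤ-◃ Sign.- n = trans (reflexive (≡.cong fromℤ (ℤ.-◃n≡-n n))) (fromℤ-neg (+ n))

  fromℤ-* : ∀ i j → fromℤ (i ℤ.* j) ≈ fromℤ i * fromℤ j
  fromℤ-* (+ m) (+ n) = trans (fromℤ-◃ Sign.+ (m ℕ.* n)) (×1-homo-* m n)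
  fromℤ-* (+ m) -[1+ n ] = begin
    fromℤ (Sign.- ℤ.◃ (m ℕ.* suc n))  ≈⟨ fromℤ-◃ Sign.- (m ℕ.* suc n) ⟩
    - ((m ℕ.* suc n) × 1#)             ≈⟨ -‿cong (×1-homo-* m (suc n)) ⟩
    - (m × 1# * suc n × 1#)            ≈⟨ -‿distribʳ-* _ _ ⟩
    m × 1# * - (suc n × 1#)            ∎
  fromℤ-* -[1+ m ] (+ n) = begin
    fromℤ (Sign.- ℤ.◃ (suc m ℕ.* n))  ≈⟨ fromℤ-◃ Sign.- (suc m ℕ.* n) ⟩
    - ((suc m ℕ.* n) × 1#)             ≈⟨ -‿cong (×1-homo-* (suc m) n) ⟩
    - (suc m × 1# * n × 1#)            ≈⟨ -‿distribˡ-* _ _ ⟩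
    - (suc m × 1#) * n × 1#            ∎
  fromℤ-* -[1+ m ] -[1+ n ] = begin
    fromℤ (Sign.+ ℤ.◃ (suc m ℕ.* suc n))     ≈⟨ fromℤ-◃ Sign.+ (suc m ℕ.* suc n) ⟩
    (suc m ℕ.* suc n) × 1#                    ≈⟨ ×1-homo-* (suc m) (suc n) ⟩
    suc m × 1# * suc n × 1#                   ≈⟨ -‿involutive _ ⟨
    - - (suc m × 1# * suc n × 1#)             ≈⟨ -‿cong (-‿distribʳ-* _ _) ⟩
    - (suc m × 1# * - (suc n × 1#))           ≈⟨ -‿distribˡ-* _ _ ⟩
    - (suc m × 1#) * - (suc n × 1#)           ∎

  ℤ-morphism : ℤ.+-*-rawRing -Raw-AlmostCommutative⟶ fromCommutativeRing CR
  ℤ-morphism = record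
    { ⟦_⟧    = fromℤ
    ; +-homo = fromℤ-+
    ; *-homo = fromℤ-*
    ; -‿homo = fromℤ-neg
    ; 0-homo = refl
    ; 1-homo = refl
    }

  coefficient-equality : WeaklyDecidable (Induced-equivalence ℤ-morphism)
  coefficient-equality m n with m ℤ.≟ n
  ... | yes m≡n = just (reflexive (≡.cong fromℤ m≡n))
  ... | no  _   = nothing

  module Solver = Algebra.Solver.Ring ℤ.+-*-rawRing (fromCommutativeRing CR)
                    ℤ-morphism coefficient-equality

commutativeRing : RealField → CommutativeRing 0ℓ 0ℓ
commutativeRing R = record { isCommutativeRing = RealField.isCommutativeRing R }

-- Positive expressions in n variables: the polynomials built from the
-- variables and 1 by sums and products.  Their values at positive
-- arguments are positive.
data PosExpr (n : ℕ) : Set where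
  atom : Fin n → PosExpr n
  one  : PosExpr n
  _⊹_ _⊛_ : PosExpr n → PosExpr n → PosExpr n

infixl 6 _⊹_
infixl 7 _⊛_

module InRealField (R : RealField) where
  open Real R
  open ≡ using (refl; sym; trans; cong; cong₂; subst; subst₂)
  private module ℝ = CommutativeRing (commutativeRing R)
  open import Algebra.Properties.Ring ℝ.ring using (-‿distribˡ-*; -‿involutive)
  open IntegerEmbedding (commutativeRing R) using (module Solver)
  open Solver using (Polynomial; con; var; _:+_; _:*_; :-_; ⟦_⟧; ⟦_⟧↓; prove)

  positive-+ : ∀ {x y} → 0ℝ < x → 0ℝ < y → 0ℝ < x + y
  positive-+ {x} {y} 0<x 0<y =
    <-trans (subst (0ℝ <_) (sym (ℝ.+-identityˡ y)) 0<y) (+-mono-< y 0<x)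

  negative⇒-positive : ∀ {x} → x < 0ℝ → 0ℝ < - x
  negative⇒-positive {x} x<0 =
    subst₂ _<_ (ℝ.-‿inverseʳ x) (ℝ.+-identityˡ (- x)) (+-mono-< (- x) x<0)

  -- 1 is positive: if 1 < 0 then 0 < (-1)(-1) = 1, a contradiction.
  0<1 : 0ℝ < 1ℝ
  0<1 with trichotomy 0ℝ 1ℝ
  ... | inj₁ 0<1         = 0<1
  ... | inj₂ (inj₁ 0≡1)  = ⊥-elim (0≢1 0≡1)
  ... | inj₂ (inj₂ 1<0)  = ⊥-elim (<-irrefl 0ℝ (<-trans 0<1′ 1<0))
    where
    -1·-1≡1 : - 1ℝ * - 1ℝ ≡ 1ℝ
    -1·-1≡1 = trans (sym (-‿distribˡ-* 1ℝ (- 1ℝ)))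
                (trans (cong -_ (ℝ.*-identityˡ (- 1ℝ))) (-‿involutive 1ℝ))
    0<1′ : 0ℝ < 1ℝ
    0<1′ = subst (0ℝ <_) -1·-1≡1
             (*-pos (negative⇒-positive 1<0) (negative⇒-positive 1<0))

  toPoly : ∀ {n} → PosExpr n → Polynomial n
  toPoly (atom k) = var k
  toPoly one      = con (+ 1)
  toPoly (e ⊹ e′) = toPoly e :+ toPoly e′
  toPoly (e ⊛ e′) = toPoly e :* toPoly e′

  posExpr-positive : ∀ {n} (ρ : Vec ℝ n) → (∀ k → 0ℝ < lookup ρ k) →
                     ∀ e → 0ℝ < ⟦ toPoly e ⟧ ρ
  posExpr-positive ρ ρ>0 (atom k) = ρ>0 k
  posExpr-positive ρ ρ>0 one      = 0<1
  posExpr-positive ρ ρ>0 (e ⊹ e′) =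
    positive-+ (posExpr-positive ρ ρ>0 e) (posExpr-positive ρ ρ>0 e′)
  posExpr-positive ρ ρ>0 (e ⊛ e′) =
    *-pos (posExpr-positive ρ ρ>0 e) (posExpr-positive ρ ρ>0 e′)

  sumF-cong : ∀ {n} {g h : Fin n → ℝ} → (∀ k → g k ≡ h k) → sumF g ≡ sumF h
  sumF-cong {zero}  g≡h = refl
  sumF-cong {suc n} g≡h = cong₂ _+_ (g≡h f0) (sumF-cong (λ k → g≡h (fs k)))

  evalPoly-cong : ∀ {n} (cs : List ℝ) {X Y : Mat n} → (∀ i j → X i j ≡ Y i j) →
                  ∀ i j → evalPoly cs X i j ≡ evalPoly cs Y i j
  evalPoly-cong []       X≡Y i j = refl
  evalPoly-cong (c ∷ cs) X≡Y i j = cong (λ s → c * I i j + s)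
    (sumF-cong (λ k → cong₂ _*_ (X≡Y i k) (evalPoly-cong cs X≡Y k j)))

  SymMat : ℕ → ℕ → Set
  SymMat m n = Fin n → Fin n → Polynomial m

  sumₚ : ∀ {m n} → (Fin n → Polynomial m) → Polynomial m
  sumₚ {n = zero}  g = con (+ 0)
  sumₚ {n = suc n} g = g f0 :+ sumₚ (λ k → g (fs k))

  Iₚ : ∀ {m n} → SymMat m n
  Iₚ i j with i Fin.≟ j
  ... | yes _ = con (+ 1)
  ... | no  _ = con (+ 0)

  evalPolyₚ : ∀ {m n} → List (Polynomial m) → SymMat m n → SymMat m n
  evalPolyₚ []       M i j = con (+ 0)
  evalPolyₚ (c ∷ cs) M i j = c :* Iₚ i j :+ sumₚ (λ k → M i k :* evalPolyₚ cs M k j)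

  ⟦sumₚ⟧ : ∀ {m n} (ρ : Vec ℝ m) (g : Fin n → Polynomial m) →
           ⟦ sumₚ g ⟧ ρ ≡ sumF (λ k → ⟦ g k ⟧ ρ)
  ⟦sumₚ⟧ {n = zero}  ρ g = refl
  ⟦sumₚ⟧ {n = suc n} ρ g = cong (λ s → ⟦ g f0 ⟧ ρ + s) (⟦sumₚ⟧ ρ (λ k → g (fs k)))

  ⟦Iₚ⟧ : ∀ {m n} (ρ : Vec ℝ m) (i j : Fin n) → ⟦ Iₚ i j ⟧ ρ ≡ I i j
  ⟦Iₚ⟧ ρ i j with i Fin.≟ j
  ... | yes _ = refl
  ... | no  _ = refl

  ⟦evalPolyₚ⟧ : ∀ {m n} (ρ : Vec ℝ m) (cs : List (Polynomial m)) (M : SymMat m n) i j →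
                ⟦ evalPolyₚ cs M i j ⟧ ρ ≡
                evalPoly (List.map (λ c → ⟦ c ⟧ ρ) cs) (λ i′ j′ → ⟦ M i′ j′ ⟧ ρ) i j
  ⟦evalPolyₚ⟧ ρ []       M i j = refl
  ⟦evalPolyₚ⟧ ρ (c ∷ cs) M i j = cong₂ (λ u v → ⟦ c ⟧ ρ * u + v) (⟦Iₚ⟧ ρ i j)
    (trans (⟦sumₚ⟧ ρ (λ k → M i k :* evalPolyₚ cs M k j))
           (sumF-cong (λ k → cong (⟦ M i k ⟧ ρ *_) (⟦evalPolyₚ⟧ ρ cs M k j))))

  -- The certificate for S₁₃.  The variables a,…,f stand for the absolute
  -- values of the nonzero entries of X.

  a b c d e f : PosExpr 6
  a = atom f0
  b = atom (fs f0)
  c = atom (fs (fs f0))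
  d = atom (fs (fs (fs f0)))
  e = atom (fs (fs (fs (fs f0))))
  f = atom (fs (fs (fs (fs (fs f0)))))

  genericMatrix : SymMat 6 3
  genericMatrix f0           f0           = con (+ 0)
  genericMatrix f0           (fs f0)      = toPoly a
  genericMatrix f0           (fs (fs f0)) = con (+ 0)
  genericMatrix (fs f0)      f0           = :- toPoly b
  genericMatrix (fs f0)      (fs f0)      = :- toPoly c
  genericMatrix (fs f0)      (fs (fs f0)) = toPoly d
  genericMatrix (fs (fs f0)) f0           = toPoly e
  genericMatrix (fs (fs f0)) (fs f0)      = :- toPoly f
  genericMatrix (fs (fs f0)) (fs (fs f0)) = con (+ 0)

  δ β α : PosExpr 6
  δ = d ⊛ e ⊛ f ⊹ a ⊛ b ⊛ e
  β = c ⊛ δ ⊹ a ⊛ d ⊛ e ⊛ e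
  α = one ⊹ a ⊛ c ⊛ d ⊛ e ⊛ e ⊹ δ ⊛ (a ⊛ b ⊹ d ⊛ f)

  certificate : List (Polynomial 6)
  certificate = toPoly α ∷ toPoly β ∷ toPoly δ ∷ []

  entry : Fin 3 → Fin 3 → PosExpr 6
  entry f0           f0           = one ⊹ a ⊛ c ⊛ d ⊛ e ⊛ e ⊹ δ ⊛ d ⊛ f
  entry f0           (fs f0)      = a ⊛ a ⊛ d ⊛ e ⊛ e
  entry f0           (fs (fs f0)) = δ ⊛ a ⊛ d
  entry (fs f0)      f0           = d ⊛ d ⊛ e ⊛ e ⊛ f
  entry (fs f0)      (fs f0)      = one
  entry (fs f0)      (fs (fs f0)) = a ⊛ d ⊛ d ⊛ e ⊛ e
  entry (fs (fs f0)) f0           = β ⊛ e ⊹ δ ⊛ b ⊛ f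
  entry (fs (fs f0)) (fs f0)      = a ⊛ a ⊛ b ⊛ e ⊛ e
  entry (fs (fs f0)) (fs (fs f0)) = one ⊹ a ⊛ c ⊛ d ⊛ e ⊛ e ⊹ δ ⊛ a ⊛ b

  certificate-identity : ∀ ρ i j →
    ⟦ evalPolyₚ certificate genericMatrix i j ⟧ ρ ≡ ⟦ toPoly (entry i j) ⟧ ρ
  certificate-identity ρ i j =
    prove ρ (evalPolyₚ certificate genericMatrix i j) (toPoly (entry i j)) (same-normal-form i j)
    where
    same-normal-form : ∀ i j → ⟦ evalPolyₚ certificate genericMatrix i j ⟧↓ ρ
                                 ≡ ⟦ toPoly (entry i j) ⟧↓ ρ
    same-normal-form f0           f0           = refl
    same-normal-form f0           (fs f0)      = refl
    same-normal-form f0           (fs (fs f0)) = refl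
    same-normal-form (fs f0)      f0           = refl
    same-normal-form (fs f0)      (fs f0)      = refl
    same-normal-form (fs f0)      (fs (fs f0)) = refl
    same-normal-form (fs (fs f0)) f0           = refl
    same-normal-form (fs (fs f0)) (fs f0)      = refl
    same-normal-form (fs (fs f0)) (fs (fs f0)) = refl

  magnitudes : Mat 3 → Vec ℝ 6
  magnitudes X = X f0 (fs f0) ∷ - X (fs f0) f0 ∷ - X (fs f0) (fs f0)
               ∷ X (fs f0) (fs (fs f0)) ∷ X (fs (fs f0)) f0 ∷ - X (fs (fs f0)) (fs f0) ∷ []

  magnitudes-positive : ∀ {X} → InQ S₁₃ X → ∀ k → 0ℝ < lookup (magnitudes X) k
  magnitudes-positive X∈Q f0                          = X∈Q f0 (fs f0)
  magnitudes-positive X∈Q (fs f0)                     = negative⇒-positive (X∈Q (fs f0) f0)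
  magnitudes-positive X∈Q (fs (fs f0))                = negative⇒-positive (X∈Q (fs f0) (fs f0))
  magnitudes-positive X∈Q (fs (fs (fs f0)))           = X∈Q (fs f0) (fs (fs f0))
  magnitudes-positive X∈Q (fs (fs (fs (fs f0))))      = X∈Q (fs (fs f0)) f0
  magnitudes-positive X∈Q (fs (fs (fs (fs (fs f0))))) = negative⇒-positive (X∈Q (fs (fs f0)) (fs f0))

  generic-form : ∀ {X} → InQ S₁₃ X → ∀ i j → X i j ≡ ⟦ genericMatrix i j ⟧ (magnitudes X)
  generic-form X∈Q f0           f0           = X∈Q f0 f0
  generic-form X∈Q f0           (fs f0)      = refl
  generic-form X∈Q f0           (fs (fs f0)) = X∈Q f0 (fs (fs f0))
  generic-form X∈Q (fs f0)      f0           = sym (-‿involutive _)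
  generic-form X∈Q (fs f0)      (fs f0)      = sym (-‿involutive _)
  generic-form X∈Q (fs f0)      (fs (fs f0)) = refl
  generic-form X∈Q (fs (fs f0)) f0           = refl
  generic-form X∈Q (fs (fs f0)) (fs f0)      = sym (-‿involutive _)
  generic-form X∈Q (fs (fs f0)) (fs (fs f0)) = X∈Q (fs (fs f0)) (fs (fs f0))

  requiresAP : RequiresAP S₁₃
  requiresAP X X∈Q = coefficients , λ i j →
      subst (0ℝ <_) (sym (entry-value i j))
        (posExpr-positive ρ (magnitudes-positive X∈Q) (entry i j))
    where
    ρ : Vec ℝ 6
    ρ = magnitudes X
    coefficients : List ℝ
    coefficients = List.map (λ p → ⟦ p ⟧ ρ) certificate
    entry-value : ∀ i j → evalPoly coefficients X i j ≡ ⟦ toPoly (entry i j) ⟧ ρ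
    entry-value i j = begin
      evalPoly coefficients X i j
        ≡⟨ evalPoly-cong coefficients (generic-form X∈Q) i j ⟩
      evalPoly coefficients (λ i′ j′ → ⟦ genericMatrix i′ j′ ⟧ ρ) i j
        ≡⟨ sym (⟦evalPolyₚ⟧ ρ certificate genericMatrix i j) ⟩
      ⟦ evalPolyₚ certificate genericMatrix i j ⟧ ρ
        ≡⟨ certificate-identity ρ i j ⟩
      ⟦ toPoly (entry i j) ⟧ ρ ∎
      where open ≡.≡-Reasoning

mainTheorem13 : (R : RealField) → Real.RequiresAP R S₁₃
mainTheorem13 R = InRealField.requiresAP R
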